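{- Let $N\ge 2$, let $A_1,A_2,\ldots$ be a quasifibonacci sequence of level $N$, and let $n\ge1$ with $S_n\neq\emptyset$. Then the poset $P_n$ has a unique maximal element $\hat 1$; moreover $\hat 1$ is the unique element of $S_n$ that does not contain $N$ consecutive $1$'s (i.e. there is no $j\ge1$ with $a_j=a_{j+1}=\cdots=a_{j+N-1}=1$). Furthermore, if $k\ge1$ and $A_k\le n<A_{k+1}$, then $l(\hat 1)=k$.
   Context: For an integer $N\ge 2$, a sequence $A_1,A_2,\ldots$ of positive integers is a quasifibonacci sequence of level $N$ if $A_{k+N}=A_{k+N-1}+\cdots+A_k$ for all $k\ge 1$, and $A_k>A_{k-1}+\cdots+A_1$ for all $1\le k\le N$. Let $\{0,1\}^{\omega}$ be the set of sequences $(a_1,a_2,\ldots)$ with $a_i\in\{0,1\}$ and $a_i=0$ for all but finitely many $i$. For $n\ge0$, $S_n=\{a\in\{0,1\}^{\omega}:\sum_{i}a_iA_i=n\}$. For nonzero $a$, $l(a)$ is the largest $i$ with $a_i=1$. The digraph $G_n$ has vertex set $S_n$, with a directed edge $a\to b$ ($a,b\in S_n$) iff there is $j\ge1$ such that $a_{j+N}=1$, $a_j=a_{j+1}=\cdots=a_{j+N-1}=0$, $b_{j+N}=0$, $b_j=b_{j+1}=\cdots=b_{j+N-1}=1$, and $a_t=b_t$ for all $t\notin\{j,\ldots,j+N\}$. The poset $P_n$ is $S_n$ ordered by $a\ge b$ iff there is a directed path in $G_n$ from $a$ to $b$. -}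

module Defs where

open import Data.Nat using (ℕ; zero; suc; _+_; _∸_; _≤_; _<_)
open import Data.Bool using (Bool; true; false; if_then_else_)
open import Data.Product using (Σ; ∃; _×_; _,_)
open import Data.Sum using (_⊎_)
open import Relation.Binary.PropositionalEquality using (_≡_)
open import Relation.Binary.Construct.Closure.ReflexiveTransitive using (Star)

-- Indices start at 1: a sequence A : ℕ → ℕ is read as A_1, A_2, ... ;
-- the value A 0 is never used.

sumFrom : (ℕ → ℕ) → ℕ → ℕ → ℕ
sumFrom f a zero    = 0
sumFrom f a (suc l) = f a + sumFrom f (suc a) l

record Quasifibonacci (N : ℕ) (A : ℕ → ℕ) : Set where
  field
    positive   : ∀ k → 1 ≤ k → 1 ≤ A k
    recurrence : ∀ k → 1 ≤ k → A (k + N) ≡ sumFrom A k N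
    initial    : ∀ k → 1 ≤ k → k ≤ N → sumFrom A 1 (k ∸ 1) < A k

-- an element of {0,1}^ω : bits a_1, a_2, ... (bits 0 unused), zero beyond some bound
record BinSeq : Set where
  field
    bits   : ℕ → Bool
    bound  : ℕ
    vanish : ∀ i → bound < i → bits i ≡ false
open BinSeq public

_≈_ : BinSeq → BinSeq → Set
a ≈ b = ∀ i → 1 ≤ i → bits a i ≡ bits b i

value : (ℕ → ℕ) → BinSeq → ℕ
value A a = sumFrom (λ i → if bits a i then A i else 0) 1 (bound a)

InS : (ℕ → ℕ) → ℕ → BinSeq → Set
InS A n a = value A a ≡ n

Edge : ℕ → BinSeq → BinSeq → Set
Edge N a b = Σ ℕ λ j → 1 ≤ j
  × bits a (j + N) ≡ true
  × (∀ t → t < N → bits a (j + t) ≡ false)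
  × bits b (j + N) ≡ false
  × (∀ t → t < N → bits b (j + t) ≡ true)
  × (∀ t → 1 ≤ t → (t < j ⊎ j + N < t) → bits a t ≡ bits b t)

EdgeG : ℕ → (ℕ → ℕ) → ℕ → BinSeq → BinSeq → Set
EdgeG N A n a b = InS A n a × InS A n b × Edge N a b

-- a ≥ b in P_n : directed path in G_n from a to b
Geq : ℕ → (ℕ → ℕ) → ℕ → BinSeq → BinSeq → Set
Geq N A n = Star (EdgeG N A n)

Maximal : ℕ → (ℕ → ℕ) → ℕ → BinSeq → Set
Maximal N A n a = InS A n a × (∀ b → InS A n b → Geq N A n b a → b ≈ a)

HasNOnes : ℕ → BinSeq → Set
HasNOnes N a = Σ ℕ λ j → 1 ≤ j × (∀ t → t < N → bits a (j + t) ≡ true)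

LastOne : BinSeq → ℕ → Set
LastOne a k = bits a k ≡ true × (∀ i → k < i → bits a i ≡ false)

module Submission where

-- Fix a quasifibonacci sequence A of level N ≥ 2 and call a 0/1-sequence
-- run-free if it contains no N consecutive 1's.  The proof rests on four facts.
--  * Growth: at most N consecutive terms A_q, …, A_{q+e} add up to at most
--    A_{q+e+1}; in particular A is strictly increasing.
--  * Greedy bound: a run-free sequence supported on 1..m has value < A_{m+1}.
--    Hence run-free sequences of equal value coincide (compare top bits).
--  * Moves: an edge a → b exchanges 0^N 1 for 1^N 0 on a window [j, j+N];
--    for any weight g this trades g_{j+N} for g_j + … + g_{j+N-1}.  With g = A
--    the recurrence makes moves value-preserving; with g = 1 the number of 1's
--    grows by N-1 ≥ 1.  Run-free elements have no incoming edge, so they are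
--    maximal; conversely, a sequence with a run has one followed by a 0, and
--    the reverse move yields a strictly larger element with fewer 1's.
--    Well-founded recursion on the number of 1's gives a run-free element of S_n.
--  * The last 1 of a run-free representation of n sits at the k with
--    A_k ≤ n < A_{k+1}, again by the greedy bound.

open import Defs
open import Data.Nat using (ℕ; zero; suc; _+_; _∸_; _≤_; _<_; z≤n; s≤s; _≤?_; _<?_; _≟_)
open import Data.Nat.Properties
open import Data.Nat.Induction using (<-wellFounded)
open import Data.Nat.Tactic.RingSolver using (solve-∀)
open import Data.Bool using (Bool; true; false; if_then_else_)
open import Data.Bool.Properties using () renaming (_≟_ to _≟ᵇ_)
open import Data.Product using (Σ; ∃; _×_; _,_; proj₁; proj₂)
open import Data.Sum using (_⊎_; inj₁; inj₂)
open import Data.Empty using (⊥; ⊥-elim)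
open import Induction.WellFounded using (Acc; acc)
open import Relation.Nullary using (¬_; Dec; yes; no)
open import Relation.Nullary.Decidable using (_×-dec_; map′)
open import Relation.Binary.PropositionalEquality
open import Relation.Binary.Construct.Closure.ReflexiveTransitive using (Star; ε; _◅_)

sumFrom-++ : ∀ g a l k → sumFrom g a (l + k) ≡ sumFrom g a l + sumFrom g (a + l) k
sumFrom-++ g a zero    k = cong (λ x → sumFrom g x k) (sym (+-identityʳ a))
sumFrom-++ g a (suc l) k = begin
  g a + sumFrom g (suc a) (l + k)                       ≡⟨ cong (g a +_) (sumFrom-++ g (suc a) l k) ⟩
  g a + (sumFrom g (suc a) l + sumFrom g (suc a + l) k) ≡⟨ sym (+-assoc (g a) _ _) ⟩
  g a + sumFrom g (suc a) l + sumFrom g (suc a + l) k   ≡⟨ cong (λ x → g a + sumFrom g (suc a) l + sumFrom g x k) (sym (+-suc a l)) ⟩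
  g a + sumFrom g (suc a) l + sumFrom g (a + suc l) k   ∎
  where open ≡-Reasoning

sumFrom-snoc : ∀ g a l → sumFrom g a (suc l) ≡ sumFrom g a l + g (a + l)
sumFrom-snoc g a l = begin
  sumFrom g a (suc l)                 ≡⟨ cong (sumFrom g a) (+-comm 1 l) ⟩
  sumFrom g a (l + 1)                 ≡⟨ sumFrom-++ g a l 1 ⟩
  sumFrom g a l + (g (a + l) + 0)     ≡⟨ cong (sumFrom g a l +_) (+-identityʳ _) ⟩
  sumFrom g a l + g (a + l)           ∎
  where open ≡-Reasoning

sumFrom-cong : ∀ {g h} a l → (∀ t → t < l → g (a + t) ≡ h (a + t)) → sumFrom g a l ≡ sumFrom h a l
sumFrom-cong {g} {h} a zero    _  = refl
sumFrom-cong {g} {h} a (suc l) eq = cong₂ _+_ head (sumFrom-cong (suc a) l tail)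
  where
  head : g a ≡ h a
  head = subst (λ x → g x ≡ h x) (+-identityʳ a) (eq 0 (s≤s z≤n))
  tail : ∀ t → t < l → g (suc a + t) ≡ h (suc a + t)
  tail t t<l = subst (λ x → g x ≡ h x) (+-suc a t) (eq (suc t) (s≤s t<l))

sumFrom-zero : ∀ a l → sumFrom (λ _ → 0) a l ≡ 0
sumFrom-zero a zero    = refl
sumFrom-zero a (suc l) = sumFrom-zero (suc a) l

sumFrom-one : ∀ a l → sumFrom (λ _ → 1) a l ≡ l
sumFrom-one a zero    = refl
sumFrom-one a (suc l) = cong suc (sumFrom-one (suc a) l)

suffix≤sumFrom : ∀ g a d l → sumFrom g (a + d) l ≤ sumFrom g a (d + l)
suffix≤sumFrom g a d l = ≤-trans (m≤n+m _ (sumFrom g a d)) (≤-reflexive (sym (sumFrom-++ g a d l)))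

masked : (ℕ → ℕ) → (ℕ → Bool) → ℕ → ℕ
masked g f i = if f i then g i else 0

maskedSum : (ℕ → ℕ) → (ℕ → Bool) → ℕ → ℕ
maskedSum g f m = sumFrom (masked g f) 1 m

weight : (ℕ → ℕ) → BinSeq → ℕ
weight g a = maskedSum g (bits a) (bound a)

onesCount : BinSeq → ℕ
onesCount = weight (λ _ → 1)

masked-ones : ∀ g f a l → (∀ t → t < l → f (a + t) ≡ true) → sumFrom (masked g f) a l ≡ sumFrom g a l
masked-ones g f a l ones = sumFrom-cong a l (λ t t<l → cong (λ b → if b then g (a + t) else 0) (ones t t<l))

masked-zeros : ∀ g f a l → (∀ t → t < l → f (a + t) ≡ false) → sumFrom (masked g f) a l ≡ 0
masked-zeros g f a l zeros =
  trans (sumFrom-cong a l (λ t t<l → cong (λ b → if b then g (a + t) else 0) (zeros t t<l))) (sumFrom-zero a l)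

maskedSum-beyond : ∀ g f m → (∀ i → m < i → f i ≡ false) → ∀ r → maskedSum g f (m + r) ≡ maskedSum g f m
maskedSum-beyond g f m above r = begin
  maskedSum g f (m + r)                          ≡⟨ sumFrom-++ (masked g f) 1 m r ⟩
  maskedSum g f m + sumFrom (masked g f) (suc m) r ≡⟨ cong (maskedSum g f m +_) (masked-zeros g f (suc m) r zeros) ⟩
  maskedSum g f m + 0                            ≡⟨ +-identityʳ _ ⟩
  maskedSum g f m                                ∎
  where
  open ≡-Reasoning
  zeros : ∀ t → t < r → f (suc m + t) ≡ false
  zeros t _ = above (suc m + t) (s≤s (m≤m+n m t))

set-bit≤maskedSum : ∀ g f m i → 1 ≤ i → i ≤ m → f i ≡ true → g i ≤ maskedSum g f m
set-bit≤maskedSum g f zero    i 1≤i i≤0   set = ⊥-elim (<⇒≱ 1≤i i≤0)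
set-bit≤maskedSum g f (suc m) i 1≤i i≤1+m set with m≤n⇒m<n∨m≡n i≤1+m
... | inj₁ (s≤s i≤m) = ≤-trans (set-bit≤maskedSum g f m i 1≤i i≤m set)
                               (≤-trans (m≤m+n _ _) (≤-reflexive (sym (sumFrom-snoc (masked g f) 1 m))))
... | inj₂ refl rewrite sumFrom-snoc (masked g f) 1 m | set = m≤n+m _ _

true≢false : ¬ (true ≡ false)
true≢false ()

set⇒≤bound : ∀ a {i} → bits a i ≡ true → i ≤ bound a
set⇒≤bound a {i} set with i ≤? bound a
... | yes i≤bound = i≤bound
... | no  i≰bound = ⊥-elim (true≢false (trans (sym set) (vanish a i (≰⇒> i≰bound))))

weight-truncate : ∀ g a m → (∀ i → m < i → bits a i ≡ false) → weight g a ≡ maskedSum g (bits a) m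
weight-truncate g a m above = begin
  maskedSum g (bits a) (bound a)      ≡⟨ sym (maskedSum-beyond g (bits a) (bound a) (vanish a) m) ⟩
  maskedSum g (bits a) (bound a + m)  ≡⟨ cong (maskedSum g (bits a)) (+-comm (bound a) m) ⟩
  maskedSum g (bits a) (m + bound a)  ≡⟨ maskedSum-beyond g (bits a) m above (bound a) ⟩
  maskedSum g (bits a) m              ∎
  where open ≡-Reasoning

weight-upto : ∀ g a L → bound a ≤ L → weight g a ≡ maskedSum g (bits a) L
weight-upto g a L le = weight-truncate g a L (λ i L<i → vanish a i (≤-<-trans le L<i))

maskedSum-exchange : ∀ g f f' j w L → 1 ≤ j → j + w ≤ L →
  (∀ i → 1 ≤ i → (i < j ⊎ j + w < i) → f i ≡ f' i) →
  maskedSum g f L + sumFrom (masked g f') j (suc w) ≡ maskedSum g f' L + sumFrom (masked g f) j (suc w)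
maskedSum-exchange g f f' (suc j') w L _ window≤L agree = begin
  maskedSum g f L + sumFrom (masked g f') (suc j') (suc w)    ≡⟨ cong (_+ sumFrom (masked g f') (suc j') (suc w)) (split f) ⟩
  P + (W + R) + W'                                            ≡⟨ cong (λ x → x + (W + R) + W') before ⟩
  P' + (W + R) + W'                                           ≡⟨ cong (λ x → P' + (W + x) + W') after ⟩
  P' + (W + R') + W'                                          ≡⟨ exchange P' W W' R' ⟩
  P' + (W' + R') + W                                          ≡⟨ cong (_+ W) (sym (split f')) ⟩
  maskedSum g f' L + sumFrom (masked g f) (suc j') (suc w)    ∎
  where
  open ≡-Reasoning
  r : ℕ
  r = L ∸ (suc j' + w)
  P P' W W' R R' : ℕ
  P  = sumFrom (masked g f) 1 j'
  P' = sumFrom (masked g f') 1 j'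
  W  = sumFrom (masked g f) (suc j') (suc w)
  W' = sumFrom (masked g f') (suc j') (suc w)
  R  = sumFrom (masked g f) (suc j' + suc w) r
  R' = sumFrom (masked g f') (suc j' + suc w) r
  L≡ : j' + (suc w + r) ≡ L
  L≡ = trans (+-suc j' (w + r)) (trans (cong suc (sym (+-assoc j' w r))) (m+[n∸m]≡n window≤L))
  split : ∀ h → maskedSum g h L ≡
    sumFrom (masked g h) 1 j' + (sumFrom (masked g h) (suc j') (suc w) + sumFrom (masked g h) (suc j' + suc w) r)
  split h = trans (cong (maskedSum g h) (sym L≡))
                  (trans (sumFrom-++ (masked g h) 1 j' (suc w + r))
                         (cong (sumFrom (masked g h) 1 j' +_) (sumFrom-++ (masked g h) (suc j') (suc w) r)))
  before : P ≡ P'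
  before = sumFrom-cong 1 j' (λ t t<j' → cong (λ b → if b then g (suc t) else 0) (agree (suc t) (s≤s z≤n) (inj₁ (s≤s t<j'))))
  after : R ≡ R'
  after = sumFrom-cong (suc j' + suc w) r (λ t _ → cong (λ b → if b then g (suc j' + suc w + t) else 0)
            (agree (suc j' + suc w + t) (s≤s z≤n) (inj₂ (≤-trans (≤-reflexive (sym (+-suc (suc j') w))) (m≤m+n _ t)))))
  exchange : ∀ p x x' s → p + (x + s) + x' ≡ p + (x' + s) + x
  exchange = solve-∀

window-ones-zero : ∀ g f j w → (∀ t → t < w → f (j + t) ≡ true) → f (j + w) ≡ false →
  sumFrom (masked g f) j (suc w) ≡ sumFrom g j w
window-ones-zero g f j w ones unset rewrite sumFrom-snoc (masked g f) j w | unset =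
  trans (+-identityʳ _) (masked-ones g f j w ones)

window-zeros-one : ∀ g f j w → (∀ t → t < w → f (j + t) ≡ false) → f (j + w) ≡ true →
  sumFrom (masked g f) j (suc w) ≡ g (j + w)
window-zeros-one g f j w zeros one rewrite sumFrom-snoc (masked g f) j w | one | masked-zeros g f j w zeros = refl

edge-weight : ∀ N g {a b} (e : Edge N a b) → weight g a + sumFrom g (proj₁ e) N ≡ weight g b + g (proj₁ e + N)
edge-weight N g {a} {b} (j , 1≤j , aTop , aZeros , bTop , bOnes , outside) = begin
  weight g a + sumFrom g j N
    ≡⟨ cong₂ _+_ (weight-upto g a L (m≤m+n _ _)) (sym (window-ones-zero g (bits b) j N bOnes bTop)) ⟩
  maskedSum g (bits a) L + sumFrom (masked g (bits b)) j (suc N)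
    ≡⟨ maskedSum-exchange g (bits a) (bits b) j N L 1≤j window≤L outside ⟩
  maskedSum g (bits b) L + sumFrom (masked g (bits a)) j (suc N)
    ≡⟨ cong₂ _+_ (sym (weight-upto g b L (m≤n+m _ _))) (window-zeros-one g (bits a) j N aZeros aTop) ⟩
  weight g b + g (j + N) ∎
  where
  open ≡-Reasoning
  L : ℕ
  L = bound a + bound b
  window≤L : j + N ≤ L
  window≤L = ≤-trans (set⇒≤bound a aTop) (m≤m+n _ _)

edge-distinct : ∀ {N a b} → Edge N a b → ¬ (a ≈ b)
edge-distinct (j , 1≤j , aTop , _ , bTop , _) same =
  true≢false (trans (sym aTop) (trans (same (j + _) (≤-trans 1≤j (m≤m+n j _))) bTop))

-- Each edge a → b turns one 1 into N ≥ 2 ones.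
edge-ones : ∀ N → 2 ≤ N → ∀ {a b} → Edge N a b → onesCount a < onesCount b
edge-ones N 2≤N {a} {b} e = ≤-pred (begin
  2 + onesCount a                                  ≤⟨ +-monoˡ-≤ (onesCount a) 2≤N ⟩
  N + onesCount a                                  ≡⟨ +-comm N _ ⟩
  onesCount a + N                                  ≡⟨ cong (onesCount a +_) (sym (sumFrom-one (proj₁ e) N)) ⟩
  onesCount a + sumFrom (λ _ → 1) (proj₁ e) N      ≡⟨ edge-weight N (λ _ → 1) {a} {b} e ⟩
  onesCount b + 1                                  ≡⟨ +-comm _ 1 ⟩
  suc (onesCount b)                                ∎)
  where open ≤-Reasoning

module QuasifibonacciRepresentations (N : ℕ) (2≤N : 2 ≤ N) (A : ℕ → ℕ) (Q : Quasifibonacci N A) where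
  open Quasifibonacci Q

  1≤N : 1 ≤ N
  1≤N = ≤-trans (s≤s z≤n) 2≤N

  -- Moves of G_n stay inside S_n: by the recurrence the exchange is value-neutral.
  edge-value : ∀ {a b} → Edge N a b → value A a ≡ value A b
  edge-value {a} {b} e@(j , 1≤j , _) = +-cancelʳ-≡ (sumFrom A j N) _ _
    (trans (edge-weight N A {a} {b} e) (cong (value A b +_) (recurrence j 1≤j)))

  -- At most N consecutive terms A_q … A_{q+e} add up to at most A_{q+e+1}:
  -- near the start by the initial condition, later as a tail of a recurrence sum.
  block≤next : ∀ q e → 1 ≤ q → e < N → sumFrom A q (suc e) ≤ A (q + suc e)
  block≤next (suc q') e _ e<N with suc q' + suc e ≤? N
  ... | yes early = ≤-trans (suffix≤sumFrom A 1 q' (suc e)) (<⇒≤ (initial (suc q' + suc e) (s≤s z≤n) early))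
  ... | no  late  = subst (λ q → sumFrom A q (suc e) ≤ A (q + suc e)) (m∸n+n≡m (<⇒≤ d<q))
                          (recurrence-tail (suc q' ∸ d) (m<n⇒0<n∸m d<q))
    where
    d : ℕ
    d = N ∸ suc e
    d+e+1≡N : d + suc e ≡ N
    d+e+1≡N = m∸n+n≡m e<N
    d<q : d < suc q'
    d<q = +-cancelʳ-< (suc e) d (suc q') (subst (_< suc q' + suc e) (sym d+e+1≡N) (≰⇒> late))
    recurrence-tail : ∀ s → 1 ≤ s → sumFrom A (s + d) (suc e) ≤ A (s + d + suc e)
    recurrence-tail s 1≤s = begin
      sumFrom A (s + d) (suc e) ≤⟨ suffix≤sumFrom A s d (suc e) ⟩
      sumFrom A s (d + suc e)   ≡⟨ cong (sumFrom A s) d+e+1≡N ⟩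
      sumFrom A s N             ≡⟨ sym (recurrence s 1≤s) ⟩
      A (s + N)                 ≡⟨ cong A (trans (cong (s +_) (sym d+e+1≡N)) (sym (+-assoc s d (suc e)))) ⟩
      A (s + d + suc e)         ∎
      where open ≤-Reasoning

  A-step : ∀ k → 1 ≤ k → A k < A (suc k)
  A-step 1 _ = subst (_< A 2) (+-identityʳ (A 1)) (initial 2 (s≤s z≤n) 2≤N)
  A-step (suc (suc k)) _ = begin-strict
    A (2 + k)                     <⟨ +-monoˡ-< (A (2 + k)) (positive (suc k) (s≤s z≤n)) ⟩
    A (1 + k) + A (2 + k)         ≡⟨ cong (A (1 + k) +_) (sym (+-identityʳ _)) ⟩
    sumFrom A (1 + k) 2           ≤⟨ block≤next (1 + k) 1 (s≤s z≤n) 2≤N ⟩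
    A (1 + k + 2)                 ≡⟨ cong (λ x → A (suc x)) (+-comm k 2) ⟩
    A (3 + k)                     ∎
    where open ≤-Reasoning

  A-monotone : ∀ i k → 1 ≤ i → i ≤ k → A i ≤ A k
  A-monotone i zero    1≤i i≤0   = ⊥-elim (<⇒≱ 1≤i i≤0)
  A-monotone i (suc k) 1≤i i≤1+k with m≤n⇒m<n∨m≡n i≤1+k
  ... | inj₁ (s≤s i≤k) = ≤-trans (A-monotone i k 1≤i i≤k) (<⇒≤ (A-step k (≤-trans 1≤i i≤k)))
  ... | inj₂ refl      = ≤-refl

  Run : (ℕ → Bool) → ℕ → Set
  Run f j = 1 ≤ j × (∀ t → t < N → f (j + t) ≡ true)

  RunFree : (ℕ → Bool) → Set
  RunFree f = ¬ Σ ℕ (Run f)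

  prepend-one : ∀ {f} q e → f (suc q) ≡ true → (∀ t → t < e → f (2 + q + t) ≡ true) →
    ∀ t → t < suc e → f (suc q + t) ≡ true
  prepend-one {f} q e bit ones zero    _         = trans (cong f (+-identityʳ (suc q))) bit
  prepend-one {f} q e bit ones (suc t) (s≤s t<e) = trans (cong f (+-suc (suc q) t)) (ones t t<e)

  -- Greedy bound, generalised for the induction on q: if f is run-free and
  -- positions q+1 … q+e carry 1's (e < N), the prefix up to q+e is below A_{q+e+1}.
  -- If position q is 0, the prefix up to q-1 is below A_q, and A_q, …, A_{q+e}
  -- is handled by block≤next; if position q is 1, the block of 1's grows by one
  -- (it cannot reach length N).
  greedy-bound-run : ∀ {f} → RunFree f → ∀ q e → e < N → (∀ t → t < e → f (suc q + t) ≡ true) →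
    maskedSum A f (q + e) < A (suc (q + e))
  greedy-bound-run {f} free zero e e<N ones =
    subst (_< A (suc e)) (sym (masked-ones A f 1 e ones)) (initial (suc e) (s≤s z≤n) e<N)
  greedy-bound-run {f} free (suc q) e e<N ones with f (suc q) in bit
  ... | false = begin-strict
    maskedSum A f (suc q + e)                                ≡⟨ cong (maskedSum A f) (sym (+-suc q e)) ⟩
    maskedSum A f (q + suc e)                                ≡⟨ sumFrom-++ (masked A f) 1 q (suc e) ⟩
    maskedSum A f q + (masked A f (suc q) + sumFrom (masked A f) (2 + q) e)
      ≡⟨ cong (λ b → maskedSum A f q + ((if b then A (suc q) else 0) + sumFrom (masked A f) (2 + q) e)) bit ⟩
    maskedSum A f q + sumFrom (masked A f) (2 + q) e         ≡⟨ cong (maskedSum A f q +_) (masked-ones A f (2 + q) e ones) ⟩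
    maskedSum A f q + sumFrom A (2 + q) e                    <⟨ +-monoˡ-< _ below-zero ⟩
    A (suc q) + sumFrom A (2 + q) e                          ≤⟨ block≤next (suc q) e (s≤s z≤n) e<N ⟩
    A (suc q + suc e)                                        ≡⟨ cong A (+-suc (suc q) e) ⟩
    A (suc (suc q + e))                                      ∎
    where
    open ≤-Reasoning
    below-zero : maskedSum A f q < A (suc q)
    below-zero = subst (λ x → maskedSum A f x < A (suc x)) (+-identityʳ q)
                       (greedy-bound-run free q 0 1≤N (λ t ()))
  ... | true with m≤n⇒m<n∨m≡n e<N
  ...   | inj₂ e+1≡N = ⊥-elim (free (suc q , s≤s z≤n , λ t t<N → prepend-one {f} q e bit ones t (subst (t <_) (sym e+1≡N) t<N)))
  ...   | inj₁ e+1<N = subst (λ x → maskedSum A f x < A (suc x)) (+-suc q e)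
                             (greedy-bound-run free q (suc e) e+1<N (prepend-one {f} q e bit ones))

  greedy-bound : ∀ {f} → RunFree f → ∀ m → maskedSum A f m < A (suc m)
  greedy-bound {f} free m = subst (λ x → maskedSum A f x < A (suc x)) (+-identityʳ m) (greedy-bound-run free m 0 1≤N (λ t ()))

  top-bit-outweighs : ∀ {f} → RunFree f → ∀ m x → x + A (suc m) ≡ maskedSum A f m + 0 → ⊥
  top-bit-outweighs {f} free m x eq = <⇒≱ (greedy-bound free m) (begin
    A (suc m)             ≤⟨ m≤n+m _ x ⟩
    x + A (suc m)         ≡⟨ eq ⟩
    maskedSum A f m + 0   ≡⟨ +-identityʳ _ ⟩
    maskedSum A f m       ∎)
    where open ≤-Reasoning

  top-bit-agrees : ∀ {f f'} → RunFree f → RunFree f' → ∀ m → maskedSum A f (suc m) ≡ maskedSum A f' (suc m) →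
    maskedSum A f m ≡ maskedSum A f' m × f (suc m) ≡ f' (suc m)
  top-bit-agrees {f} {f'} free free' m eq
    rewrite sumFrom-snoc (masked A f) 1 m | sumFrom-snoc (masked A f') 1 m with f (suc m) | f' (suc m)
  ... | true  | true  = +-cancelʳ-≡ (A (suc m)) _ _ eq , refl
  ... | false | false = +-cancelʳ-≡ 0 _ _ eq , refl
  ... | true  | false = ⊥-elim (top-bit-outweighs free' m _ eq)
  ... | false | true  = ⊥-elim (top-bit-outweighs free m _ (sym eq))

  runFree-prefix-unique : ∀ {f f'} → RunFree f → RunFree f' → ∀ m → maskedSum A f m ≡ maskedSum A f' m →
    ∀ i → 1 ≤ i → i ≤ m → f i ≡ f' i
  runFree-prefix-unique free free' zero    eq i 1≤i i≤0 = ⊥-elim (<⇒≱ 1≤i i≤0)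
  runFree-prefix-unique free free' (suc m) eq i 1≤i i≤1+m with m≤n⇒m<n∨m≡n i≤1+m
  ... | inj₁ (s≤s i≤m) = runFree-prefix-unique free free' m (proj₁ (top-bit-agrees free free' m eq)) i 1≤i i≤m
  ... | inj₂ refl      = proj₂ (top-bit-agrees free free' m eq)

  runFree-unique : ∀ a b → RunFree (bits a) → RunFree (bits b) → value A a ≡ value A b → a ≈ b
  runFree-unique a b free free' eq i 1≤i = compare (i ≤? L)
    where
    L : ℕ
    L = bound a + bound b
    compare : Dec (i ≤ L) → bits a i ≡ bits b i
    compare (yes i≤L) = runFree-prefix-unique free free' L eqL i 1≤i i≤L
      where
      eqL : maskedSum A (bits a) L ≡ maskedSum A (bits b) L
      eqL = trans (sym (weight-upto A a L (m≤m+n _ _))) (trans eq (weight-upto A b L (m≤n+m _ _)))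
    compare (no i≰L) = trans (vanish a i (≤-<-trans (m≤m+n _ _) (≰⇒> i≰L)))
                             (sym (vanish b i (≤-<-trans (m≤n+m _ _) (≰⇒> i≰L))))

  edge-target-run : ∀ {z a} → Edge N z a → Σ ℕ (Run (bits a))
  edge-target-run (j , 1≤j , _ , _ , _ , ones , _) = j , 1≤j , ones

  -- A run-free element has no incoming edge, so every path ending there is trivial.
  runFree⇒maximal : ∀ {n a} → InS A n a → RunFree (bits a) → Maximal N A n a
  runFree⇒maximal {n} {a} a∈Sn free = a∈Sn , λ b _ path → only-trivial-paths path
    where
    -- the last edge of a nonempty path would enter a
    no-nonempty-path : ∀ {x y} → EdgeG N A n x y → Star (EdgeG N A n) y a → ⊥
    no-nonempty-path {x} (_ , _ , e) ε = free (edge-target-run {x} {a} e)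
    no-nonempty-path {y = y} _ (_◅_ {j = z} e es) = no-nonempty-path {y} {z} e es
    only-trivial-paths : ∀ {b} → Star (EdgeG N A n) b a → b ≈ a
    only-trivial-paths ε                      = λ i _ → refl
    only-trivial-paths {b} (_◅_ {j = z} e es) = ⊥-elim (no-nonempty-path {b} {z} e es)

  -- Sliding a run to the right as long as the next bit is 1 ends, before the
  -- bound is passed, at a run followed by a 0.
  run-before-zero : ∀ c d j → bound c < j + d → Run (bits c) j →
    Σ ℕ λ j' → Run (bits c) j' × bits c (j' + N) ≡ false
  run-before-zero c zero    j beyond (_ , ones) = ⊥-elim (true≢false (trans (sym (ones 0 1≤N)) (vanish c (j + 0) beyond)))
  run-before-zero c (suc d) j beyond (1≤j , ones) with bits c (j + N) in next
  ... | false = j , (1≤j , ones) , next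
  ... | true  = run-before-zero c d (suc j) (subst (bound c <_) (+-suc j d) beyond) (s≤s z≤n , shifted)
    where
    shifted : ∀ t → t < N → bits c (suc j + t) ≡ true
    shifted t t<N with m≤n⇒m<n∨m≡n t<N
    ... | inj₁ t+1<N = trans (cong (bits c) (sym (+-suc j t))) (ones (suc t) t+1<N)
    ... | inj₂ t+1≡N = trans (cong (bits c) (trans (sym (+-suc j t)) (cong (j +_) t+1≡N))) next

  -- The reverse move at a run j followed by a 0: the window 1^N 0 becomes 0^N 1.
  module Lift (c : BinSeq) (j : ℕ) (run : Run (bits c) j) (unset : bits c (j + N) ≡ false) where
    liftedBits : ℕ → Bool
    liftedBits i with j ≤? i | i <? j + N | i ≟ j + N
    ... | yes _ | yes _ | _     = false
    ... | _     | _     | yes _ = true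
    ... | _     | _     | no _  = bits c i

    lifted-window : ∀ t → t < N → liftedBits (j + t) ≡ false
    lifted-window t t<N with j ≤? j + t | j + t <? j + N | j + t ≟ j + N
    ... | yes _    | yes _ | _ = refl
    ... | no j≰j+t | _     | _ = ⊥-elim (j≰j+t (m≤m+n j t))
    ... | yes _    | no ≮  | _ = ⊥-elim (≮ (+-monoʳ-< j t<N))

    lifted-top : liftedBits (j + N) ≡ true
    lifted-top with j ≤? j + N | j + N <? j + N | j + N ≟ j + N
    ... | _     | yes < | _     = ⊥-elim (<-irrefl refl <)
    ... | _     | _     | no ≢  = ⊥-elim (≢ refl)
    ... | yes _ | no _  | yes _ = refl
    ... | no _  | no _  | yes _ = refl

    lifted-outside : ∀ i → (i < j ⊎ j + N < i) → liftedBits i ≡ bits c i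
    lifted-outside i (inj₁ i<j) with j ≤? i | i <? j + N | i ≟ j + N
    ... | yes j≤i | _ | _        = ⊥-elim (<⇒≱ i<j j≤i)
    ... | no _    | _ | yes refl = ⊥-elim (<⇒≱ i<j (m≤m+n j N))
    ... | no _    | _ | no _     = refl
    lifted-outside i (inj₂ j+N<i) with j ≤? i | i <? j + N | i ≟ j + N
    ... | _     | yes i<j+N | _        = ⊥-elim (<-asym j+N<i i<j+N)
    ... | _     | _         | yes refl = ⊥-elim (<-irrefl refl j+N<i)
    ... | yes _ | no _      | no _     = refl
    ... | no _  | no _      | no _     = refl

    lifted : BinSeq
    lifted = record { bits = liftedBits ; bound = bound c + N ; vanish = beyond }
      where
      beyond : ∀ i → bound c + N < i → liftedBits i ≡ false
      beyond i lt = trans (lifted-outside i (inj₂ (≤-<-trans (+-monoˡ-≤ N j≤bound) lt)))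
                          (vanish c i (≤-<-trans (m≤m+n (bound c) N) lt))
        where
        j≤bound : j ≤ bound c
        j≤bound = set⇒≤bound c (trans (cong (bits c) (sym (+-identityʳ j))) (proj₂ run 0 1≤N))

    lift-edge : Edge N lifted c
    lift-edge = j , proj₁ run , lifted-top , lifted-window , unset , proj₂ run , λ t _ p → lifted-outside t p

  run⇒incoming-edge : ∀ c → Σ ℕ (Run (bits c)) → Σ BinSeq λ c' → Edge N c' c
  run⇒incoming-edge c (j₀ , run₀) with run-before-zero c (suc (bound c)) j₀ (m≤n+m (suc (bound c)) j₀) run₀
  ... | j , run , unset = lifted , lift-edge
    where open Lift c j run unset

  -- A maximal element is run-free: an incoming edge would come from a
  -- different element of S_n above it.
  maximal⇒runFree : ∀ {n c} → Maximal N A n c → RunFree (bits c)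
  maximal⇒runFree {n} {c} (c∈Sn , maximal) run with run⇒incoming-edge c run
  ... | c' , e = edge-distinct {a = c'} {b = c} e (maximal c' c'∈Sn ((c'∈Sn , c∈Sn , e) ◅ ε))
    where
    c'∈Sn : InS A n c'
    c'∈Sn = trans (edge-value {c'} {c} e) c∈Sn

  run? : ∀ f j → Dec (Run f j)
  run? f j = (1 ≤? j) ×-dec map′ (λ ones t t<N → ones t<N) (λ ones {t} t<N → ones t t<N)
                                 (allUpTo? (λ t → f (j + t) ≟ᵇ true) N)

  -- Having a run is decidable, since a run starts within the bound.
  hasRun? : ∀ a → Dec (Σ ℕ (Run (bits a)))
  hasRun? a = map′ (λ (j , _ , r) → j , r) (λ (j , r) → j , s≤s (start≤bound j r) , r)
                   (anyUpTo? (run? (bits a)) (suc (bound a)))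
    where
    start≤bound : ∀ j → Run (bits a) j → j ≤ bound a
    start≤bound j (_ , ones) = set⇒≤bound a (trans (cong (bits a) (sym (+-identityʳ j))) (ones 0 1≤N))

  -- Reverse moves, repeated while a run remains, reach a run-free element of
  -- the same value; they stop because each one lowers the number of 1's.
  runFree-representative : ∀ w → Acc _<_ (onesCount w) → Σ BinSeq λ t → value A t ≡ value A w × RunFree (bits t)
  runFree-representative w (acc smaller) with hasRun? w
  ... | no free = w , refl , free
  ... | yes run with run⇒incoming-edge w run
  ...   | w' , e with runFree-representative w' (smaller (edge-ones N 2≤N {w'} {w} e))
  ...     | t , same-value , free = t , trans same-value (edge-value {w'} {w} e) , free

  -- In a run-free representation of n, the last 1 is at the k with A_k ≤ n < A_{k+1}:
  -- a 1 beyond k would give n ≥ A_{k+1}, and a 0 at k would give n < A_k.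
  runFree-lastOne : ∀ n top → InS A n top → RunFree (bits top) → ∀ k → 1 ≤ k → A k ≤ n → n < A (suc k) → LastOne top k
  runFree-lastOne n top top∈Sn free (suc k) _ Ak≤n n<Ak+1 = last-set , above-unset
    where
    above-unset : ∀ i → suc k < i → bits top i ≡ false
    above-unset i k+1<i with bits top i in set
    ... | false = refl
    ... | true  = ⊥-elim (<⇒≱ n<Ak+1 (begin
      A (suc (suc k))            ≤⟨ A-monotone (suc (suc k)) i (s≤s z≤n) k+1<i ⟩
      A i                        ≤⟨ set-bit≤maskedSum A (bits top) (bound top) i (≤-trans (s≤s z≤n) k+1<i) (set⇒≤bound top set) set ⟩
      value A top                ≡⟨ top∈Sn ⟩
      n                          ∎))
      where open ≤-Reasoning
    last-set : bits top (suc k) ≡ true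
    last-set with bits top (suc k) in unset
    ... | true  = refl
    ... | false = ⊥-elim (<⇒≱ (greedy-bound free k) (begin
      A (suc k)                                ≤⟨ Ak≤n ⟩
      n                                        ≡⟨ sym top∈Sn ⟩
      value A top                              ≡⟨ weight-truncate A top (suc k) above-unset ⟩
      maskedSum A (bits top) (suc k)           ≡⟨ sumFrom-snoc (masked A (bits top)) 1 k ⟩
      maskedSum A (bits top) k + masked A (bits top) (suc k)
        ≡⟨ cong (λ b → maskedSum A (bits top) k + (if b then A (suc k) else 0)) unset ⟩
      maskedSum A (bits top) k + 0             ≡⟨ +-identityʳ _ ⟩
      maskedSum A (bits top) k                 ∎))
      where open ≤-Reasoning

proposition3p1 : ∀ (N : ℕ) → 2 ≤ N → (A : ℕ → ℕ) → Quasifibonacci N A →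
    ∀ (n : ℕ) → 1 ≤ n → (∃ λ w → InS A n w) →
    Σ BinSeq λ top →
    Maximal N A n top
    × (∀ c → Maximal N A n c → c ≈ top)
    × ¬ HasNOnes N top
    × (∀ b → InS A n b → ¬ HasNOnes N b → b ≈ top)
    × (∀ k → 1 ≤ k → A k ≤ n → n < A (suc k) → LastOne top k)
-- The maximal element is the run-free representative of n.
proposition3p1 N 2≤N A Q n _ (w , w∈Sn) =
    top
  , runFree⇒maximal top∈Sn free
  , (λ c c-max → runFree-unique c top (maximal⇒runFree c-max) free (trans (proj₁ c-max) (sym top∈Sn)))
  , free
  , (λ b b∈Sn b-free → runFree-unique b top b-free free (trans b∈Sn (sym top∈Sn)))
  , runFree-lastOne n top top∈Sn free
  where
  open QuasifibonacciRepresentations N 2≤N A Q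
  representative : Σ BinSeq λ t → value A t ≡ value A w × RunFree (bits t)
  representative = runFree-representative w (<-wellFounded (onesCount w))
  top : BinSeq
  top = proj₁ representative
  top∈Sn : InS A n top
  top∈Sn = trans (proj₁ (proj₂ representative)) w∈Sn
  free : RunFree (bits top)
  free = proj₂ (proj₂ representative)
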